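{- Let $m,n\ge 2$ be integers and let $G_{m,n}=P_m\,\Box\,P_n$ be the grid graph. Then $$SW_3(G_{m,n})=\frac{1}{12}\left(m^4n^3+m^3n^4-3m^3n^2-3m^2n^3+2m^2n+2mn^2\right).$$
   Context: $P_k$ is the path on $k$ vertices and $\Box$ is the Cartesian product of graphs. For nonempty $S\subseteq V(G)$, the Steiner distance $d(S)$ is the minimum number of edges of a connected subgraph of $G$ whose vertex set contains $S$, and $SW_3(G)=\sum_{S\subseteq V(G),|S|=3}d(S)$. -}

module Defs where

open import Data.Nat using (ℕ; zero; suc; _+_; _*_; _≤_)
open import Data.Nat.ListAction using (sum)
open import Data.Fin using (Fin; toℕ)
open import Data.List using (List; []; _∷_; length; map; _++_; cartesianProduct; allFin)
open import Data.List.Membership.Propositional using (_∈_)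
open import Data.List.Relation.Unary.All using (All)
open import Data.List.Relation.Unary.AllPairs using (AllPairs)
open import Data.Product using (Σ; _×_; _,_; ∃)
open import Data.Sum using (_⊎_)
open import Relation.Binary.PropositionalEquality using (_≡_)
open import Relation.Nullary using (¬_)

-- Finite graphs: a vertex type, an adjacency relation, and a list
-- enumerating every vertex exactly once (for the concrete graphs below
-- this is allFin k resp. the cartesian product of enumerations).

record Graph : Set₁ where
  field
    V     : Set
    Adj   : V → V → Set
    verts : List V
open Graph public

P : ℕ → Graph
P k = record
  { V     = Fin k
  ; Adj   = λ a b → (suc (toℕ a) ≡ toℕ b) ⊎ (suc (toℕ b) ≡ toℕ a)
  ; verts = allFin k
  }

_□_ : Graph → Graph → Graph
G □ H = record
  { V     = V G × V H
  ; Adj   = λ { (g , h) (g' , h') →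
              (g ≡ g' × Adj H h h') ⊎ (h ≡ h' × Adj G g g') }
  ; verts = cartesianProduct (verts G) (verts H)
  }

Grid : ℕ → ℕ → Graph
Grid m n = P m □ P n

module _ (G : Graph) where

  SameEdge : V G × V G → V G × V G → Set
  SameEdge (a , b) (c , d) = ((a ≡ c) × (b ≡ d)) ⊎ ((a ≡ d) × (b ≡ c))

  record Subgraph : Set where
    field
      hv       : List (V G)
      he       : List (V G × V G)
      edgesOfG : All (λ { (a , b) → Adj G a b }) he
      ends     : All (λ { (a , b) → (a ∈ hv) × (b ∈ hv) }) he
      distinct : AllPairs (λ e f → ¬ SameEdge e f) he
  open Subgraph public

  ‖_‖ : Subgraph → ℕ
  ‖ H ‖ = length (he H)

  data Walk (H : Subgraph) : V G → V G → Set where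
    here : ∀ {u} → Walk H u u
    step : ∀ {u w v} → ((u , w) ∈ he H) ⊎ ((w , u) ∈ he H) →
           Walk H w v → Walk H u v

  Connected : Subgraph → Set
  Connected H = (∃ λ v → v ∈ hv H) × (∀ u v → u ∈ hv H → v ∈ hv H → Walk H u v)

  ConnectedOver : List (V G) → Subgraph → Set
  ConnectedOver S H = Connected H × All (λ s → s ∈ hv H) S

  IsSteinerDistance : List (V G) → ℕ → Set
  IsSteinerDistance S k =
    (Σ Subgraph λ H → ConnectedOver S H × ‖ H ‖ ≡ k) ×
    (∀ H → ConnectedOver S H → k ≤ ‖ H ‖)

-- 3-element subsets of a list with distinct entries: all sublists of
-- length 3 (each unordered triple exactly once).

pairsOf : ∀ {A : Set} → List A → List (List A)
pairsOf []       = []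
pairsOf (x ∷ xs) = map (λ y → x ∷ y ∷ []) xs ++ pairsOf xs

triplesOf : ∀ {A : Set} → List A → List (List A)
triplesOf []       = []
triplesOf (x ∷ xs) = map (x ∷_) (pairsOf xs) ++ triplesOf xs

3-subsets : (G : Graph) → List (List (V G))
3-subsets G = triplesOf (verts G)

SW₃ : (G : Graph) → (List (V G) → ℕ) → ℕ
SW₃ G d = sum (map d (3-subsets G))

-- For three vertices the Steiner distance is the sum of the column range and the row range of
-- the triple: a tree made of geodesics from a coordinatewise median attains it, and a connected
-- subgraph containing the triple needs a separate edge for every column gap and every row gap it
-- has to bridge. Twice the range of three numbers is the sum of their pairwise distances, so
-- 2 SW₃ sums the pairwise grid distances over all triples; every pair lies in mn − 2 triples, and
-- the pairwise distances of the path P_k add up to (k³ − k)/6. Steiner distances exist for every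
-- vertex list because a smallest covering tree can be found by enumeration and every connected
-- subgraph contains a spanning tree with no more edges.
module Submission where

open import Data.Empty using (⊥; ⊥-elim)
open import Data.Fin using (Fin; toℕ; fromℕ<; inject₁) renaming (zero to fzero; suc to fsuc; _≟_ to _≟ᶠ_)
open import Data.Fin.Properties using (toℕ-injective; toℕ<n; toℕ-fromℕ<; toℕ-inject₁)
open import Data.List using (List; []; _∷_; length; map; _++_; applyUpTo; cartesianProduct; cartesianProductWith; allFin)
open import Data.List.Membership.Propositional using (_∈_; _∉_; find; lose)
open import Data.List.Membership.Propositional.Properties using (∈-cartesianProductWith⁺; ∈-cartesianProduct⁺; ∈-allFin; ∈-map⁺; ∈-++⁻; ∈-applyUpTo⁻)
open import Data.List.Properties using (map-++; length-map; length-++; map-tabulate; length-tabulate; length-applyUpTo; length-removeAt′)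
open import Data.List.Relation.Unary.All as All using (All; []; _∷_; universal)
open import Data.List.Relation.Unary.All.Properties using (++⁺; map⁺)
open import Data.List.Relation.Unary.AllPairs using (AllPairs; []; _∷_)
open import Data.List.Relation.Unary.Any as Any using (here; there; _─_)
open import Data.List.Relation.Unary.Unique.Propositional using (Unique)
import Data.List.Relation.Unary.Unique.Propositional.Properties as Unique
open import Data.Nat using (ℕ; zero; suc; _+_; _*_; _^_; _∸_; _⊓_; ∣_-_∣; _≤_; _<_; _≥_; z≤n; s≤s) renaming (_≟_ to _≟ℕ_)
open import Data.Nat.Induction using (<-rec)
open import Data.Nat.ListAction using (sum)
open import Data.Nat.ListAction.Properties using (sum-++)
open import Data.Nat.Properties
open import Algebra.Properties.CommutativeSemigroup +-commutativeSemigroup using () renaming (interchange to +-interchange)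
open import Data.Nat.Tactic.RingSolver using (solve-∀)
open import Data.Product using (Σ; ∃; ∃-syntax; _×_; _,_; proj₁; proj₂)
open import Data.Product.Properties using (≡-dec)
open import Data.Sum using (_⊎_; inj₁; inj₂; [_,_])
open import Data.Sum.Properties using (inj₁-injective; inj₂-injective)
open import Defs
open import Function using (case_of_)
open import Relation.Binary using (DecidableEquality; tri<; tri≈; tri>)
open import Relation.Binary.PropositionalEquality hiding ([_])
open import Relation.Nullary using (¬_; Dec; yes; no; ¬?; contradiction)
open import Relation.Nullary.Decidable using (_×-dec_; _⊎-dec_)
open import Relation.Unary using (Decidable)

private variable A B : Set

Σ[_] : List A → (A → ℕ) → ℕ
Σ[ xs ] f = sum (map f xs)

Σ-cong : ∀ (xs : List A) {f g : A → ℕ} → (∀ x → f x ≡ g x) → Σ[ xs ] f ≡ Σ[ xs ] g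
Σ-cong []       f≗g = refl
Σ-cong (x ∷ xs) f≗g = cong₂ _+_ (f≗g x) (Σ-cong xs f≗g)

Σ-map : ∀ (xs : List B) (g : B → A) (f : A → ℕ) → Σ[ map g xs ] f ≡ Σ[ xs ] (λ x → f (g x))
Σ-map []       g f = refl
Σ-map (x ∷ xs) g f = cong (f (g x) +_) (Σ-map xs g f)

Σ-++ : ∀ (xs ys : List A) (f : A → ℕ) → Σ[ xs ++ ys ] f ≡ Σ[ xs ] f + Σ[ ys ] f
Σ-++ xs ys f = trans (cong sum (map-++ f xs ys)) (sum-++ (map f xs) (map f ys))

Σ-+ : ∀ (xs : List A) (f g : A → ℕ) → Σ[ xs ] (λ x → f x + g x) ≡ Σ[ xs ] f + Σ[ xs ] g
Σ-+ []       f g = refl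
Σ-+ (x ∷ xs) f g = trans (cong (f x + g x +_) (Σ-+ xs f g)) (+-interchange (f x) (g x) _ _)

Σ-*ˡ : ∀ (xs : List A) (c : ℕ) (f : A → ℕ) → Σ[ xs ] (λ x → c * f x) ≡ c * Σ[ xs ] f
Σ-*ˡ []       c f = sym (*-zeroʳ c)
Σ-*ˡ (x ∷ xs) c f = trans (cong (c * f x +_) (Σ-*ˡ xs c f)) (sym (*-distribˡ-+ c (f x) _))

Σ-const : ∀ (xs : List A) (c : ℕ) → Σ[ xs ] (λ _ → c) ≡ length xs * c
Σ-const []       c = refl
Σ-const (x ∷ xs) c = cong (c +_) (Σ-const xs c)

Σ-cong-All : ∀ {xs : List A} {f g : A → ℕ} → All (λ x → f x ≡ g x) xs → Σ[ xs ] f ≡ Σ[ xs ] g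
Σ-cong-All []         = refl
Σ-cong-All (fx≡gx ∷ eqs) = cong₂ _+_ fx≡gx (Σ-cong-All eqs)

-- Sums over 2- and 3-subsets

Σ-pairsOf-Σ : ∀ (xs : List A) (f : A → ℕ) →
  Σ[ pairsOf xs ] (λ p → Σ[ p ] f) + Σ[ xs ] f ≡ length xs * Σ[ xs ] f
Σ-pairsOf-Σ []       f = refl
Σ-pairsOf-Σ (y ∷ ys) f = begin
  Σ[ map (λ z → y ∷ z ∷ []) ys ++ pairsOf ys ] (λ p → Σ[ p ] f) + (f y + σ)
    ≡⟨ cong (_+ (f y + σ)) (Σ-++ (map (λ z → y ∷ z ∷ []) ys) (pairsOf ys) (λ p → Σ[ p ] f)) ⟩
  (Σ[ map (λ z → y ∷ z ∷ []) ys ] (λ p → Σ[ p ] f) + π) + (f y + σ)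
    ≡⟨ cong (λ t → (t + π) + (f y + σ)) pairs-with-y ⟩
  ((length ys * f y + σ) + π) + (f y + σ)
    ≡⟨ regroup (length ys * f y) (f y) σ π ⟩
  length ys * f y + f y + σ + (π + σ)
    ≡⟨ cong (length ys * f y + f y + σ +_) (Σ-pairsOf-Σ ys f) ⟩
  length ys * f y + f y + σ + length ys * σ
    ≡⟨ factor (length ys) (f y) σ ⟩
  suc (length ys) * (f y + σ) ∎
  where
  open ≡-Reasoning
  regroup : ∀ a b c d → ((a + c) + d) + (b + c) ≡ a + b + c + (d + c)
  regroup = solve-∀
  factor : ∀ k a b → k * a + a + b + k * b ≡ suc k * (a + b)
  factor = solve-∀
  σ π : ℕ
  σ = Σ[ ys ] f
  π = Σ[ pairsOf ys ] (λ p → Σ[ p ] f)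
  pairs-with-y : Σ[ map (λ z → y ∷ z ∷ []) ys ] (λ p → Σ[ p ] f) ≡ length ys * f y + σ
  pairs-with-y = begin
    Σ[ map (λ z → y ∷ z ∷ []) ys ] (λ p → Σ[ p ] f) ≡⟨ Σ-map ys _ (λ p → Σ[ p ] f) ⟩
    Σ[ ys ] (λ z → f y + (f z + 0))                ≡⟨ Σ-+ ys (λ _ → f y) (λ z → f z + 0) ⟩
    Σ[ ys ] (λ _ → f y) + Σ[ ys ] (λ z → f z + 0)  ≡⟨ cong₂ _+_ (Σ-const ys (f y)) (Σ-cong ys (λ z → +-identityʳ (f z))) ⟩
    length ys * f y + σ                            ∎

module _ (w : A → A → ℕ) where

  pairwiseSum : List A → ℕ
  pairwiseSum []       = 0
  pairwiseSum (x ∷ xs) = Σ[ xs ] (w x) + pairwiseSum xs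

  Σ-pairsOf-pairwiseSum : ∀ xs → Σ[ pairsOf xs ] pairwiseSum ≡ pairwiseSum xs
  Σ-pairsOf-pairwiseSum []       = refl
  Σ-pairsOf-pairwiseSum (x ∷ xs) = begin
    Σ[ map (λ y → x ∷ y ∷ []) xs ++ pairsOf xs ] pairwiseSum
      ≡⟨ Σ-++ (map (λ y → x ∷ y ∷ []) xs) (pairsOf xs) pairwiseSum ⟩
    Σ[ map (λ y → x ∷ y ∷ []) xs ] pairwiseSum + Σ[ pairsOf xs ] pairwiseSum
      ≡⟨ cong₂ _+_ (trans (Σ-map xs _ pairwiseSum) (Σ-cong xs pair)) (Σ-pairsOf-pairwiseSum xs) ⟩
    Σ[ xs ] (w x) + pairwiseSum xs ∎
    where
    open ≡-Reasoning
    pair : ∀ y → pairwiseSum (x ∷ y ∷ []) ≡ w x y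
    pair y = trans (+-identityʳ _) (+-identityʳ (w x y))

  -- Each pair of xs lies in length xs ∸ 2 of its 3-subsets.
  Σ-triplesOf-pairwiseSum : ∀ xs →
    Σ[ triplesOf xs ] pairwiseSum + 2 * pairwiseSum xs ≡ length xs * pairwiseSum xs
  Σ-triplesOf-pairwiseSum []       = refl
  Σ-triplesOf-pairwiseSum (x ∷ xs) = begin
    Σ[ map (x ∷_) (pairsOf xs) ++ triplesOf xs ] pairwiseSum + 2 * (σ + π)
      ≡⟨ cong (_+ 2 * (σ + π)) (Σ-++ (map (x ∷_) (pairsOf xs)) (triplesOf xs) pairwiseSum) ⟩
    (Σ[ map (x ∷_) (pairsOf xs) ] pairwiseSum + τ) + 2 * (σ + π)
      ≡⟨ cong (λ t → (t + τ) + 2 * (σ + π)) triples-with-x ⟩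
    ((ρ + π) + τ) + 2 * (σ + π)
      ≡⟨ regroup ρ π τ σ ⟩
    (ρ + σ) + σ + π + (τ + 2 * π)
      ≡⟨ cong₂ (λ a b → a + σ + π + b) (Σ-pairsOf-Σ xs (w x)) (Σ-triplesOf-pairwiseSum xs) ⟩
    length xs * σ + σ + π + length xs * π
      ≡⟨ factor (length xs) σ π ⟩
    suc (length xs) * (σ + π) ∎
    where
    open ≡-Reasoning
    σ π τ ρ : ℕ
    σ = Σ[ xs ] (w x)
    π = pairwiseSum xs
    τ = Σ[ triplesOf xs ] pairwiseSum
    ρ = Σ[ pairsOf xs ] (λ p → Σ[ p ] (w x))
    triples-with-x : Σ[ map (x ∷_) (pairsOf xs) ] pairwiseSum ≡ ρ + π
    triples-with-x = begin
      Σ[ map (x ∷_) (pairsOf xs) ] pairwiseSum              ≡⟨ Σ-map (pairsOf xs) (x ∷_) pairwiseSum ⟩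
      Σ[ pairsOf xs ] (λ p → Σ[ p ] (w x) + pairwiseSum p)  ≡⟨ Σ-+ (pairsOf xs) (λ p → Σ[ p ] (w x)) pairwiseSum ⟩
      ρ + Σ[ pairsOf xs ] pairwiseSum                       ≡⟨ cong (ρ +_) (Σ-pairsOf-pairwiseSum xs) ⟩
      ρ + π                                                 ∎
    regroup : ∀ a b c d → ((a + b) + c) + 2 * (d + b) ≡ (a + d) + d + b + (c + 2 * b)
    regroup = solve-∀
    factor : ∀ k a b → k * a + a + b + k * b ≡ suc k * (a + b)
    factor = solve-∀

  2*pairwiseSum≡ΣΣ : (∀ x y → w x y ≡ w y x) → (∀ x → w x x ≡ 0) →
    ∀ xs → 2 * pairwiseSum xs ≡ Σ[ xs ] (λ x → Σ[ xs ] (w x))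
  2*pairwiseSum≡ΣΣ w-sym w-refl []       = refl
  2*pairwiseSum≡ΣΣ w-sym w-refl (x ∷ xs) = begin
    2 * (σ + π)                                            ≡⟨ double σ π ⟩
    σ + (σ + 2 * π)                                        ≡⟨ cong (λ t → σ + (t + 2 * π)) (Σ-cong xs (w-sym x)) ⟩
    σ + (Σ[ xs ] (λ y → w y x) + 2 * π)                    ≡⟨ cong (λ t → σ + (Σ[ xs ] (λ y → w y x) + t)) (2*pairwiseSum≡ΣΣ w-sym w-refl xs) ⟩
    σ + (Σ[ xs ] (λ y → w y x) + Σ[ xs ] (λ y → Σ[ xs ] (w y)))
      ≡⟨ cong₂ (λ a b → a + σ + b) (sym (w-refl x)) (sym (Σ-+ xs (λ y → w y x) (λ y → Σ[ xs ] (w y)))) ⟩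
    w x x + σ + Σ[ xs ] (λ y → w y x + Σ[ xs ] (w y)) ∎
    where
    open ≡-Reasoning
    σ π : ℕ
    σ = Σ[ xs ] (w x)
    π = pairwiseSum xs
    double : ∀ a b → 2 * (a + b) ≡ a + (a + 2 * b)
    double = solve-∀

pairsOf-shape : ∀ (xs : List A) → All (λ p → ∃[ a ] ∃[ b ] p ≡ a ∷ b ∷ []) (pairsOf xs)
pairsOf-shape []       = []
pairsOf-shape (x ∷ xs) = ++⁺ (map⁺ (universal (λ y → x , y , refl) xs)) (pairsOf-shape xs)

triplesOf-shape : ∀ (xs : List A) → All (λ t → ∃[ a ] ∃[ b ] ∃[ c ] t ≡ a ∷ b ∷ c ∷ []) (triplesOf xs)
triplesOf-shape []       = []
triplesOf-shape (x ∷ xs) =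
  ++⁺ (map⁺ (All.map (λ { (a , b , refl) → x , a , b , refl }) (pairsOf-shape xs))) (triplesOf-shape xs)

Σ-cartesianProduct : ∀ (xs : List A) (ys : List B) (f : A × B → ℕ) →
  Σ[ cartesianProduct xs ys ] f ≡ Σ[ xs ] (λ x → Σ[ ys ] (λ y → f (x , y)))
Σ-cartesianProduct []       ys f = refl
Σ-cartesianProduct (x ∷ xs) ys f = trans (Σ-++ (map (x ,_) ys) (cartesianProduct xs ys) f)
  (cong₂ _+_ (Σ-map ys (x ,_) f) (Σ-cartesianProduct xs ys f))

length-cartesianProduct : ∀ (xs : List A) (ys : List B) → length (cartesianProduct xs ys) ≡ length xs * length ys
length-cartesianProduct []       ys = refl
length-cartesianProduct (x ∷ xs) ys =
  trans (length-++ (map (x ,_) ys)) (cong₂ _+_ (length-map (x ,_) ys) (length-cartesianProduct xs ys))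

Σ-cartesianProduct-proj₁ : ∀ (xs : List A) (ys : List B) (f : A → ℕ) →
  Σ[ cartesianProduct xs ys ] (λ u → f (proj₁ u)) ≡ length ys * Σ[ xs ] f
Σ-cartesianProduct-proj₁ xs ys f = begin
  Σ[ cartesianProduct xs ys ] (λ u → f (proj₁ u)) ≡⟨ Σ-cartesianProduct xs ys _ ⟩
  Σ[ xs ] (λ x → Σ[ ys ] (λ _ → f x))             ≡⟨ Σ-cong xs (λ x → Σ-const ys (f x)) ⟩
  Σ[ xs ] (λ x → length ys * f x)                 ≡⟨ Σ-*ˡ xs (length ys) f ⟩
  length ys * Σ[ xs ] f                           ∎
  where open ≡-Reasoning

Σ-cartesianProduct-proj₂ : ∀ (xs : List A) (ys : List B) (f : B → ℕ) →
  Σ[ cartesianProduct xs ys ] (λ u → f (proj₂ u)) ≡ length xs * Σ[ ys ] f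
Σ-cartesianProduct-proj₂ xs ys f = begin
  Σ[ cartesianProduct xs ys ] (λ u → f (proj₂ u)) ≡⟨ Σ-cartesianProduct xs ys _ ⟩
  Σ[ xs ] (λ _ → Σ[ ys ] f)                       ≡⟨ Σ-const xs _ ⟩
  length xs * Σ[ ys ] f                           ∎
  where open ≡-Reasoning

ΣΣ-cartesianProduct : ∀ (xs : List A) (ys : List B) (f : A → A → ℕ) (g : B → B → ℕ) →
  let zs = cartesianProduct xs ys in
  Σ[ zs ] (λ u → Σ[ zs ] (λ v → f (proj₁ u) (proj₁ v) + g (proj₂ u) (proj₂ v)))
    ≡ length ys * length ys * Σ[ xs ] (λ x → Σ[ xs ] (f x))
      + length xs * length xs * Σ[ ys ] (λ y → Σ[ ys ] (g y))
ΣΣ-cartesianProduct {A = A} {B = B} xs ys f g = begin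
  Σ[ zs ] (λ u → Σ[ zs ] (λ v → f (proj₁ u) (proj₁ v) + g (proj₂ u) (proj₂ v)))
    ≡⟨ Σ-cong zs (λ u → Σ-+ zs _ _) ⟩
  Σ[ zs ] (λ u → Σ[ zs ] (λ v → f (proj₁ u) (proj₁ v)) + Σ[ zs ] (λ v → g (proj₂ u) (proj₂ v)))
    ≡⟨ Σ-cong zs (λ u → cong₂ _+_ (Σ-cartesianProduct-proj₁ xs ys (f (proj₁ u)))
                                   (Σ-cartesianProduct-proj₂ xs ys (g (proj₂ u)))) ⟩
  Σ[ zs ] (λ u → length ys * F (proj₁ u) + length xs * G (proj₂ u))
    ≡⟨ Σ-+ zs _ _ ⟩
  Σ[ zs ] (λ u → length ys * F (proj₁ u)) + Σ[ zs ] (λ u → length xs * G (proj₂ u))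
    ≡⟨ cong₂ _+_ (Σ-cartesianProduct-proj₁ xs ys _) (Σ-cartesianProduct-proj₂ xs ys _) ⟩
  length ys * Σ[ xs ] (λ x → length ys * F x) + length xs * Σ[ ys ] (λ y → length xs * G y)
    ≡⟨ cong₂ _+_ (cong (length ys *_) (Σ-*ˡ xs (length ys) F)) (cong (length xs *_) (Σ-*ˡ ys (length xs) G)) ⟩
  length ys * (length ys * Σ[ xs ] F) + length xs * (length xs * Σ[ ys ] G)
    ≡⟨ cong₂ _+_ (sym (*-assoc (length ys) _ _)) (sym (*-assoc (length xs) _ _)) ⟩
  length ys * length ys * Σ[ xs ] F + length xs * length xs * Σ[ ys ] G ∎
  where
  open ≡-Reasoning
  zs : List (A × B)
  zs = cartesianProduct xs ys
  F : A → ℕ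
  F x = Σ[ xs ] (f x)
  G : B → ℕ
  G y = Σ[ ys ] (g y)

-- Distances on a path

Σ-allFin-suc : ∀ k (f : Fin (suc k) → ℕ) → Σ[ allFin (suc k) ] f ≡ f fzero + Σ[ allFin k ] (λ i → f (fsuc i))
Σ-allFin-suc k f = cong (λ xs → f fzero + sum xs)
  (trans (map-tabulate fsuc f) (sym (map-tabulate (λ i → i) (λ i → f (fsuc i)))))

length-allFin : ∀ k → length (allFin k) ≡ k
length-allFin k = length-tabulate (λ i → i)

triangular : ∀ k → 2 * Σ[ allFin k ] (λ i → suc (toℕ i)) ≡ k * suc k
triangular zero    = refl
triangular (suc k) = begin
  2 * Σ[ allFin (suc k) ] (λ i → suc (toℕ i))    ≡⟨ cong (2 *_) (Σ-allFin-suc k (λ i → suc (toℕ i))) ⟩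
  2 * (1 + Σ[ allFin k ] (λ i → 1 + suc (toℕ i))) ≡⟨ cong (λ t → 2 * (1 + t)) (Σ-+ (allFin k) (λ _ → 1) _) ⟩
  2 * (1 + (Σ[ allFin k ] (λ _ → 1) + τ))         ≡⟨ cong (λ t → 2 * (1 + (t + τ))) (trans (Σ-const (allFin k) 1) (cong (_* 1) (length-allFin k))) ⟩
  2 * (1 + (k * 1 + τ))                           ≡⟨ regroup k τ ⟩
  2 * τ + 2 * (1 + k)                             ≡⟨ cong (_+ 2 * (1 + k)) (triangular k) ⟩
  k * suc k + 2 * (1 + k)                         ≡⟨ expand k ⟩
  suc k * suc (suc k)                             ∎
  where
  open ≡-Reasoning
  τ : ℕ
  τ = Σ[ allFin k ] (λ i → suc (toℕ i))
  regroup : ∀ k t → 2 * (1 + (k * 1 + t)) ≡ 2 * t + 2 * (1 + k)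
  regroup = solve-∀
  expand : ∀ k → k * suc k + 2 * (1 + k) ≡ suc k * suc (suc k)
  expand = solve-∀

pathDistanceSum : ℕ → ℕ
pathDistanceSum k = Σ[ allFin k ] (λ i → Σ[ allFin k ] (λ j → ∣ toℕ i - toℕ j ∣))

3*pathDistanceSum+k≡k³ : ∀ k → 3 * pathDistanceSum k + k ≡ k * k * k
3*pathDistanceSum+k≡k³ zero    = refl
3*pathDistanceSum+k≡k³ (suc k) = begin
  3 * pathDistanceSum (suc k) + suc k            ≡⟨ cong (λ t → 3 * t + suc k) unfold ⟩
  3 * (τ + (τ + pathDistanceSum k)) + suc k      ≡⟨ regroup τ (pathDistanceSum k) k ⟩
  3 * (2 * τ) + (3 * pathDistanceSum k + k) + 1  ≡⟨ cong₂ (λ a b → 3 * a + b + 1) (triangular k) (3*pathDistanceSum+k≡k³ k) ⟩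
  3 * (k * suc k) + k * k * k + 1                ≡⟨ expand k ⟩
  suc k * suc k * suc k                          ∎
  where
  open ≡-Reasoning
  τ : ℕ
  τ = Σ[ allFin k ] (λ i → suc (toℕ i))
  row : Fin (suc k) → ℕ
  row i = Σ[ allFin (suc k) ] (λ j → ∣ toℕ i - toℕ j ∣)
  unfold : pathDistanceSum (suc k) ≡ τ + (τ + pathDistanceSum k)
  unfold = begin
    Σ[ allFin (suc k) ] row                                      ≡⟨ Σ-allFin-suc k row ⟩
    row fzero + Σ[ allFin k ] (λ i → row (fsuc i))               ≡⟨ cong₂ _+_ (Σ-allFin-suc k (λ j → toℕ j))
                                                                      (Σ-cong (allFin k) (λ i → Σ-allFin-suc k (λ j → ∣ suc (toℕ i) - toℕ j ∣))) ⟩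
    τ + Σ[ allFin k ] (λ i → suc (toℕ i) + Σ[ allFin k ] (λ j → ∣ toℕ i - toℕ j ∣))
                                                                 ≡⟨ cong (τ +_) (Σ-+ (allFin k) _ _) ⟩
    τ + (τ + pathDistanceSum k)                                  ∎
  regroup : ∀ t d k → 3 * (t + (t + d)) + suc k ≡ 3 * (2 * t) + (3 * d + k) + 1
  regroup = solve-∀
  expand : ∀ k → 3 * (k * suc k) + k * k * k + 1 ≡ suc k * suc k * suc k
  expand = solve-∀

-- Three points on a line

module _ {a b c : ℕ} (a≤b : a ≤ b) (b≤c : b ≤ c) where

  sorted-mid-sum : ∣ b - a ∣ + ∣ b - b ∣ + ∣ b - c ∣ ≡ c ∸ a
  sorted-mid-sum with m≤n⇒∃[o]m+o≡n a≤b | m≤n⇒∃[o]m+o≡n b≤c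
  ... | p , refl | q , refl = begin
    ∣ a + p - a ∣ + ∣ a + p - (a + p) ∣ + ∣ a + p - (a + p + q) ∣
      ≡⟨ cong₂ _+_ (cong₂ _+_ (trans (∣-∣-comm (a + p) a) (∣m-m+n∣≡n a p)) (∣n-n∣≡0 (a + p)))
                   (∣m-m+n∣≡n (a + p) q) ⟩
    p + 0 + q          ≡⟨ cong (_+ q) (+-identityʳ p) ⟩
    p + q              ≡⟨ m+n∸m≡n a (p + q) ⟨
    a + (p + q) ∸ a    ≡⟨ cong (_∸ a) (+-assoc a p q) ⟨
    a + p + q ∸ a      ∎
    where open ≡-Reasoning

  sorted-pairwise-sum : ∣ a - b ∣ + ∣ a - c ∣ + ∣ b - c ∣ ≡ 2 * (c ∸ a)
  sorted-pairwise-sum with m≤n⇒∃[o]m+o≡n a≤b | m≤n⇒∃[o]m+o≡n b≤c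
  ... | p , refl | q , refl = begin
    ∣ a - a + p ∣ + ∣ a - a + p + q ∣ + ∣ a + p - a + p + q ∣
      ≡⟨ cong₂ _+_ (cong₂ _+_ (∣m-m+n∣≡n a p) (trans (cong ∣ a -_∣ (+-assoc a p q)) (∣m-m+n∣≡n a (p + q))))
                   (∣m-m+n∣≡n (a + p) q) ⟩
    p + (p + q) + q    ≡⟨ double p q ⟩
    2 * (p + q)        ≡⟨ cong (2 *_) (m+n∸m≡n a (p + q)) ⟨
    2 * (a + (p + q) ∸ a) ≡⟨ cong (λ t → 2 * (t ∸ a)) (+-assoc a p q) ⟨
    2 * (a + p + q ∸ a) ∎
    where
    open ≡-Reasoning
    double : ∀ p q → p + (p + q) + q ≡ 2 * (p + q)
    double = solve-∀

module _ {X : Set} (key : X → ℕ) where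

  record Spread (x y z : X) : Set where
    field
      lo mid hi    : X
      lo∈          : lo ∈ x ∷ y ∷ z ∷ []
      hi∈          : hi ∈ x ∷ y ∷ z ∷ []
      lo≤hi        : key lo ≤ key hi
      mid-sum      : ∣ key mid - key x ∣ + ∣ key mid - key y ∣ + ∣ key mid - key z ∣ ≡ key hi ∸ key lo
      pairwise-sum : ∣ key x - key y ∣ + ∣ key x - key z ∣ + ∣ key y - key z ∣ ≡ 2 * (key hi ∸ key lo)

    width : ℕ
    width = key hi ∸ key lo

  private
    ∈-swap₁₂ : ∀ {v x y} {zs : List X} → v ∈ x ∷ y ∷ zs → v ∈ y ∷ x ∷ zs
    ∈-swap₁₂ (here v≡x)          = there (here v≡x)
    ∈-swap₁₂ (there (here v≡y))  = here v≡y
    ∈-swap₁₂ (there (there v∈zs)) = there (there v∈zs)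

    ∈-swap₂₃ : ∀ {v x y z} → v ∈ x ∷ y ∷ z ∷ [] → v ∈ x ∷ z ∷ y ∷ []
    ∈-swap₂₃ (here v≡x)  = here v≡x
    ∈-swap₂₃ (there v∈ys) = there (∈-swap₁₂ v∈ys)

    +-swap₁₂ : ∀ a b c → a + b + c ≡ b + a + c
    +-swap₁₂ = solve-∀

    +-swap₂₃ : ∀ a b c → a + b + c ≡ a + c + b
    +-swap₂₃ = solve-∀

  sorted-spread : ∀ {x y z} → key x ≤ key y → key y ≤ key z → Spread x y z
  sorted-spread x≤y y≤z = record
    { lo = _ ; mid = _ ; hi = _ ; lo∈ = here refl ; hi∈ = there (there (here refl))
    ; lo≤hi = ≤-trans x≤y y≤z
    ; mid-sum = sorted-mid-sum x≤y y≤z ; pairwise-sum = sorted-pairwise-sum x≤y y≤z }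

  spread-swap₁₂ : ∀ {x y z} → Spread x y z → Spread y x z
  spread-swap₁₂ {x} {y} s = record
    { lo = lo ; mid = mid ; hi = hi ; lo∈ = ∈-swap₁₂ lo∈ ; hi∈ = ∈-swap₁₂ hi∈ ; lo≤hi = lo≤hi
    ; mid-sum = trans (+-swap₁₂ (∣ key mid - key y ∣) _ _) mid-sum
    ; pairwise-sum = trans (cong (λ t → t + _ + _) (∣-∣-comm (key y) (key x)))
                           (trans (+-swap₂₃ (∣ key x - key y ∣) _ _) pairwise-sum) }
    where open Spread s

  spread-swap₂₃ : ∀ {x y z} → Spread x y z → Spread x z y
  spread-swap₂₃ {x} {y} {z} s = record
    { lo = lo ; mid = mid ; hi = hi ; lo∈ = ∈-swap₂₃ lo∈ ; hi∈ = ∈-swap₂₃ hi∈ ; lo≤hi = lo≤hi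
    ; mid-sum = trans (+-swap₂₃ (∣ key mid - key x ∣) _ _) mid-sum
    ; pairwise-sum = trans (cong (∣ key x - key z ∣ + ∣ key x - key y ∣ +_) (∣-∣-comm (key z) (key y)))
                           (trans (+-swap₁₂ (∣ key x - key z ∣) _ _) pairwise-sum) }
    where open Spread s

  spread : ∀ x y z → Spread x y z
  spread x y z with ≤-total (key x) (key y) | ≤-total (key y) (key z) | ≤-total (key x) (key z)
  ... | inj₁ x≤y | inj₁ y≤z | _        = sorted-spread x≤y y≤z
  ... | inj₁ x≤y | inj₂ z≤y | inj₁ x≤z = spread-swap₂₃ (sorted-spread x≤z z≤y)
  ... | inj₁ x≤y | inj₂ z≤y | inj₂ z≤x = spread-swap₂₃ (spread-swap₁₂ (sorted-spread z≤x x≤y))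
  ... | inj₂ y≤x | inj₁ y≤z | inj₁ x≤z = spread-swap₁₂ (sorted-spread y≤x x≤z)
  ... | inj₂ y≤x | inj₁ y≤z | inj₂ z≤x = spread-swap₁₂ (spread-swap₂₃ (sorted-spread y≤z z≤x))
  ... | inj₂ y≤x | inj₂ z≤y | _        =
    spread-swap₁₂ (spread-swap₂₃ (spread-swap₁₂ (sorted-spread z≤y y≤x)))

-- Spanning trees and Steiner distances

Minimum : (ℕ → Set) → ℕ → Set
Minimum P j = P j × (∀ {i} → P i → j ≤ i)

minimal : {P : ℕ → Set} → Decidable P → ∀ {k} → P k → ∃ (Minimum P)
minimal {P} P? {k} = <-rec (λ k → P k → ∃ (Minimum P)) below k
  where
  below : ∀ k → (∀ {j} → j < k → P j → ∃ (Minimum P)) → P k → ∃ (Minimum P)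
  below k rec Pk with anyUpTo? P? k
  ... | yes (j , j<k , Pj) = rec j<k Pj
  ... | no none            = k , Pk , λ Pi → ≮⇒≥ (λ i<k → none (_ , i<k , Pi))

module _ {x : A} where

  ∈-─ : ∀ {y xs} (x∈xs : x ∈ xs) → y ∈ xs → y ≡ x ⊎ y ∈ (xs ─ x∈xs)
  ∈-─ (here refl)  (here refl)  = inj₁ refl
  ∈-─ (here _)     (there y∈xs) = inj₂ y∈xs
  ∈-─ (there _)    (here refl)  = inj₂ (here refl)
  ∈-─ (there x∈xs) (there y∈xs) with ∈-─ x∈xs y∈xs
  ... | inj₁ y≡x     = inj₁ y≡x
  ... | inj₂ y∈xs─x  = inj₂ (there y∈xs─x)

  ─-⊆ : ∀ {y xs} (x∈xs : x ∈ xs) → y ∈ (xs ─ x∈xs) → y ∈ xs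
  ─-⊆ (here _)     y∈xs─x         = there y∈xs─x
  ─-⊆ (there _)    (here refl)    = here refl
  ─-⊆ (there x∈xs) (there y∈xs─x) = there (─-⊆ x∈xs y∈xs─x)

length-≤-⊆ : ∀ {xs ys : List A} → Unique xs → (∀ {x} → x ∈ xs → x ∈ ys) → length xs ≤ length ys
length-≤-⊆ {xs = []}     _               _     = z≤n
length-≤-⊆ {xs = x ∷ xs} {ys} (x∉xs ∷ dxs) xs⊆ys = begin
  suc (length xs)         ≤⟨ s≤s (length-≤-⊆ dxs xs⊆ys─x) ⟩
  suc (length (ys ─ x∈ys)) ≡⟨ length-removeAt′ ys (Any.index x∈ys) ⟨
  length ys               ∎
  where
  open ≤-Reasoning
  x∈ys : x ∈ ys
  x∈ys = xs⊆ys (here refl)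
  xs⊆ys─x : ∀ {y} → y ∈ xs → y ∈ (ys ─ x∈ys)
  xs⊆ys─x {y} y∈xs with ∈-─ x∈ys (xs⊆ys (there y∈xs))
  ... | inj₁ refl  = contradiction refl (All.lookup x∉xs y∈xs)
  ... | inj₂ y∈ys─x = y∈ys─x

steinerDistance-≡ : ∀ {G S k r} → IsSteinerDistance G S k →
  (H : Subgraph G) → ConnectedOver G S H → ‖_‖ G H ≤ r →
  (∀ H′ → ConnectedOver G S H′ → r ≤ ‖_‖ G H′) → k ≡ r
steinerDistance-≡ ((H₀ , H₀-over , ‖H₀‖≡k) , minimum) H H-over ‖H‖≤r lower =
  ≤-antisym (≤-trans (minimum H H-over) ‖H‖≤r) (subst (_ ≤_) ‖H₀‖≡k (lower H₀ H₀-over))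

module _ {G : Graph} (adj-sym : ∀ {u v} → Adj G u v → Adj G v u)
         {L : Set} (key : V G → ℕ) (label : V G × V G → L) (level : ℕ → L)
         (crosses : ∀ {u w c} → Adj G u w → key u ≤ c → c < key w →
                    label (u , w) ≡ level c × label (w , u) ≡ level c) where

  walk-crosses : ∀ {H u v c} → Walk G H u v → key u ≤ c → c < key v → level c ∈ map label (he H)
  walk-crosses here u≤c c<v = contradiction (≤-<-trans u≤c c<v) (<-irrefl refl)
  walk-crosses {H} {c = c} (step {w = w} uw p) u≤c c<v with key w ≤? c | uw
  ... | yes w≤c | _          = walk-crosses p w≤c c<v
  ... | no w≰c  | inj₁ uw∈H =
    subst (_∈ map label (he H)) (proj₁ (crosses (All.lookup (edgesOfG H) uw∈H) u≤c (≰⇒> w≰c)))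
          (∈-map⁺ label uw∈H)
  ... | no w≰c  | inj₂ wu∈H =
    subst (_∈ map label (he H)) (proj₂ (crosses (adj-sym (All.lookup (edgesOfG H) wu∈H)) u≤c (≰⇒> w≰c)))
          (∈-map⁺ label wu∈H)

  walk-crosses-levels : ∀ {H u v} → Walk G H u v → key u ≤ key v →
    ∀ {l} → l ∈ applyUpTo (λ i → level (key u + i)) (key v ∸ key u) → l ∈ map label (he H)
  walk-crosses-levels {u = u} p u≤v l∈levels with ∈-applyUpTo⁻ _ l∈levels
  ... | i , i<width , refl =
    walk-crosses p (m≤m+n (key u) i) (subst (key u + i <_) (m+[n∸m]≡n u≤v) (+-monoʳ-< (key u) i<width))

module GrowthTrees (G : Graph) (_≟_ : DecidableEquality (V G))
                   (adj-sym : ∀ {u v} → Adj G u v → Adj G v u) where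

  open import Data.List.Membership.DecPropositional _≟_ using (_∈?_)

  Vertex Edge : Set
  Vertex = V G
  Edge   = Vertex × Vertex

  private variable
    H H′ : Subgraph G
    u v w : Vertex

  _++ʷ_ : Walk G H u v → Walk G H v w → Walk G H u w
  here     ++ʷ q = q
  step e p ++ʷ q = step e (p ++ʷ q)

  reverseʷ : Walk G H u v → Walk G H v u
  reverseʷ here             = here
  reverseʷ (step (inj₁ e) p) = reverseʷ p ++ʷ step (inj₂ e) here
  reverseʷ (step (inj₂ e) p) = reverseʷ p ++ʷ step (inj₁ e) here

  mapʷ : (∀ {e} → e ∈ he H → e ∈ he H′) → Walk G H u v → Walk G H′ u v
  mapʷ f here              = here
  mapʷ f (step (inj₁ e) p) = step (inj₁ (f e)) (mapʷ f p)
  mapʷ f (step (inj₂ e) p) = step (inj₂ (f e)) (mapʷ f p)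

  Within : List Vertex → Edge → Set
  Within vs (a , b) = a ∈ vs × b ∈ vs

  -- A tree on the vertex list vs, grown from its last vertex by attaching new vertices.
  data Tree : List Vertex → Set where
    root : ∀ v → Tree (v ∷ [])
    grow : ∀ {vs w} u → u ∈ vs → Adj G u w → w ∉ vs → Tree vs → Tree (w ∷ vs)

  treeRoot : ∀ {vs} → Tree vs → Vertex
  treeRoot (root v)           = v
  treeRoot (grow _ _ _ _ t)   = treeRoot t

  treeRoot∈ : ∀ {vs} (t : Tree vs) → treeRoot t ∈ vs
  treeRoot∈ (root v)         = here refl
  treeRoot∈ (grow _ _ _ _ t) = there (treeRoot∈ t)

  treeEdges : ∀ {vs} → Tree vs → List Edge
  treeEdges (root v)                   = []
  treeEdges (grow {w = w} u _ _ _ t) = (u , w) ∷ treeEdges t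

  length-tree : ∀ {vs} (t : Tree vs) → length vs ≡ suc (length (treeEdges t))
  length-tree (root v)         = refl
  length-tree (grow _ _ _ _ t) = cong suc (length-tree t)

  private
    treeEnds : ∀ {vs} (t : Tree vs) → All (Within vs) (treeEdges t)
    treeEnds (root v)             = []
    treeEnds (grow u u∈vs _ _ t) =
      (there u∈vs , here refl) ∷ All.map (λ { (a∈ , b∈) → there a∈ , there b∈ }) (treeEnds t)

    treeAdj : ∀ {vs} (t : Tree vs) → All (λ e → Adj G (proj₁ e) (proj₂ e)) (treeEdges t)
    treeAdj (root v)             = []
    treeAdj (grow _ _ u~w _ t) = u~w ∷ treeAdj t

    -- The edge added last is new because its end w was not yet a vertex.
    treeDistinct : ∀ {vs} (t : Tree vs) → AllPairs (λ e f → ¬ SameEdge G e f) (treeEdges t)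
    treeDistinct (root v)                    = []
    treeDistinct (grow {vs} {w} u _ _ w∉vs t) = All.map new (treeEnds t) ∷ treeDistinct t
      where
      new : ∀ {e} → Within vs e → ¬ SameEdge G (u , w) e
      new (_ , b∈vs) (inj₁ (_ , refl)) = w∉vs b∈vs
      new (a∈vs , _) (inj₂ (_ , refl)) = w∉vs a∈vs

  treeSubgraph : ∀ {vs} → Tree vs → Subgraph G
  treeSubgraph {vs} t = record
    { hv = vs ; he = treeEdges t ; edgesOfG = treeAdj t ; ends = treeEnds t ; distinct = treeDistinct t }

  walk-to-root : ∀ {vs} (t : Tree vs) → v ∈ vs → Walk G (treeSubgraph t) v (treeRoot t)
  walk-to-root (root v)              (here refl) = here
  walk-to-root (grow u u∈vs _ _ t) (here refl) = step (inj₂ (here refl)) (mapʷ there (walk-to-root t u∈vs))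
  walk-to-root (grow _ _ _ _ t)      (there v∈vs) = mapʷ there (walk-to-root t v∈vs)

  tree-connected : ∀ {vs} (t : Tree vs) → Connected G (treeSubgraph t)
  tree-connected t =
    (treeRoot t , treeRoot∈ t) ,
    λ x y x∈ y∈ → walk-to-root t x∈ ++ʷ reverseʷ (walk-to-root t y∈)

  module _ (H : Subgraph G) where

    Crossing : List Vertex → Edge → Set
    Crossing vs (a , b) = (a ∈ vs × b ∉ vs) ⊎ (b ∈ vs × a ∉ vs)

    crossing? : ∀ (vs : List Vertex) e → Dec (Crossing vs e)
    crossing? vs (a , b) = ((a ∈? vs) ×-dec ¬? (b ∈? vs)) ⊎-dec ((b ∈? vs) ×-dec ¬? (a ∈? vs))

    Closed : List Vertex → Set
    Closed vs = ∀ {e} → e ∈ he H → ¬ Crossing vs e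

    closed-reach : ∀ {vs} → Closed vs → Walk G H u v → u ∈ vs → v ∈ vs
    closed-reach cl here u∈vs = u∈vs
    closed-reach {vs = vs} cl (step {w = w} uw p) u∈vs with w ∈? vs | uw
    ... | yes w∈vs | _          = closed-reach cl p w∈vs
    ... | no w∉vs  | inj₁ uw∈H = contradiction (inj₁ (u∈vs , w∉vs)) (cl uw∈H)
    ... | no w∉vs  | inj₂ wu∈H = contradiction (inj₂ (u∈vs , w∉vs)) (cl wu∈H)

    private
      orient : ∀ {vs e} → e ∈ he H → Crossing vs e →
               ∃[ u ] ∃[ w ] (u ∈ vs × w ∉ vs × Adj G u w × Within (w ∷ vs) e)
      orient {e = a , b} e∈H (inj₁ (a∈vs , b∉vs)) =
        a , b , a∈vs , b∉vs , All.lookup (edgesOfG H) e∈H , there a∈vs , here refl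
      orient {e = a , b} e∈H (inj₂ (b∈vs , a∉vs)) =
        b , a , b∈vs , a∉vs , adj-sym (All.lookup (edgesOfG H) e∈H) , here refl , there b∈vs

    record SpanningExtension (vs₀ : List Vertex) : Set where
      field
        vertices : List Vertex
        tree     : Tree vertices
        closed   : Closed vertices
        extends  : ∀ {x} → x ∈ vs₀ → x ∈ vertices
        bounded  : length vertices ≤ suc (length (he H))

    -- Repeatedly attach an unused edge of H leaving the current vertex set; R holds the unused edges.
    extend : ∀ k {vs} (t : Tree vs) (R : List Edge) → length R ≡ k →
             (∀ {e} → e ∈ R → e ∈ he H) → (∀ {e} → e ∈ he H → e ∈ R ⊎ Within vs e) →
             length vs + length R ≤ suc (length (he H)) → SpanningExtension vs
    extend k {vs} t R |R|≡k R⊆H H⊆R∪vs bound with Any.any? (crossing? vs) R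
    ... | no none = record
      { vertices = vs ; tree = t ; extends = λ x∈vs → x∈vs ; bounded = ≤-trans (m≤m+n _ _) bound
      ; closed = λ e∈H cr → [ (λ e∈R → none (lose e∈R cr)) , (λ e∈vs → uncrossed e∈vs cr) ] (H⊆R∪vs e∈H) }
      where
      uncrossed : ∀ {e} → Within vs e → ¬ Crossing vs e
      uncrossed (_ , b∈vs) (inj₁ (_ , b∉vs)) = b∉vs b∈vs
      uncrossed (a∈vs , _) (inj₂ (_ , a∉vs)) = a∉vs a∈vs
    ... | yes some with find some
    ...   | e , e∈R , cr with k | orient (R⊆H e∈R) cr
    ...     | zero  | _ = contradiction (trans (sym |R|≡k) (length-removeAt′ R (Any.index e∈R))) (λ ())
    ...     | suc k | u , w , u∈vs , w∉vs , u~w , e-within = record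
      { SpanningExtension next ; extends = λ x∈vs → SpanningExtension.extends next (there x∈vs) }
      where
      |R|≡1+|R─e| : length R ≡ suc (length (R ─ e∈R))
      |R|≡1+|R─e| = length-removeAt′ R (Any.index e∈R)
      H⊆R─e∪wvs : ∀ {f} → f ∈ he H → f ∈ (R ─ e∈R) ⊎ Within (w ∷ vs) f
      H⊆R─e∪wvs f∈H with H⊆R∪vs f∈H
      ... | inj₂ (a∈vs , b∈vs) = inj₂ (there a∈vs , there b∈vs)
      ... | inj₁ f∈R with ∈-─ e∈R f∈R
      ...   | inj₁ refl   = inj₂ e-within
      ...   | inj₂ f∈R─e = inj₁ f∈R─e
      next : SpanningExtension (w ∷ vs)
      next = extend k (grow u u∈vs u~w w∉vs t) (R ─ e∈R)
        (suc-injective (trans (sym |R|≡1+|R─e|) |R|≡k)) (λ f∈R─e → R⊆H (─-⊆ e∈R f∈R─e)) H⊆R─e∪wvs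
        (≤-trans (≤-reflexive (trans (sym (+-suc (length vs) _)) (cong (length vs +_) (sym |R|≡1+|R─e|)))) bound)

    spanning-tree : Connected G H →
      ∃[ vs ] Σ (Tree vs) λ t → (∀ {x} → x ∈ hv H → x ∈ vs) × length (treeEdges t) ≤ ‖_‖ G H
    spanning-tree ((v , v∈H) , walks) =
      vertices , tree ,
      (λ x∈H → closed-reach closed (walks v _ v∈H x∈H) (extends (here refl))) ,
      ≤-pred (subst (_≤ suc (length (he H))) (length-tree tree) bounded)
      where open SpanningExtension (extend _ (root v) (he H) refl (λ e∈H → e∈H) inj₁ ≤-refl)

  module _ (adj? : ∀ u v → Dec (Adj G u v)) (∈-verts : ∀ v → v ∈ verts G) where

    tree? : ∀ vs → Dec (Tree vs)
    tree? []                 = no λ ()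
    tree? (v ∷ [])           = yes (root v)
    tree? (w ∷ vs@(_ ∷ _)) with w ∈? vs | Any.any? (λ u → adj? u w) vs | tree? vs
    ... | yes w∈vs | _        | _     = no λ { (grow _ _ _ w∉vs _) → w∉vs w∈vs }
    ... | no _     | no ¬u~w  | _     = no λ { (grow _ u∈vs u~w _ _) → ¬u~w (lose u∈vs u~w) }
    ... | no _     | yes _    | no ¬t = no λ { (grow _ _ _ _ t) → ¬t t }
    ... | no w∉vs  | yes some | yes t with find some
    ...   | u , u∈vs , u~w = yes (grow u u∈vs u~w w∉vs t)

    listsOfLength : ℕ → List (List Vertex)
    listsOfLength zero    = [] ∷ []
    listsOfLength (suc k) = cartesianProductWith _∷_ (verts G) (listsOfLength k)

    ∈-listsOfLength : ∀ vs → vs ∈ listsOfLength (length vs)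
    ∈-listsOfLength []       = here refl
    ∈-listsOfLength (v ∷ vs) = ∈-cartesianProductWith⁺ _∷_ (∈-verts v) (∈-listsOfLength vs)

    TreeCover : List Vertex → ℕ → Set
    TreeCover S k = ∃[ vs ] (Tree vs × length vs ≡ suc k × All (_∈ vs) S)

    treeCover? : ∀ S k → Dec (TreeCover S k)
    treeCover? S k with Any.any? (λ vs → tree? vs ×-dec (length vs ≟ℕ suc k) ×-dec All.all? (_∈? vs) S)
                                (listsOfLength (suc k))
    ... | yes some = let vs , _ , cover = find some in yes (vs , cover)
    ... | no none  = no λ { (vs , cover@(_ , |vs|≡1+k , _)) →
                       none (lose (subst (λ j → vs ∈ listsOfLength j) |vs|≡1+k (∈-listsOfLength vs)) cover) }

    -- Minimal covering trees realise the Steiner distance, since every connected subgraph has a spanning tree.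
    steinerDistance : ∀ S {vs} → Tree vs → All (_∈ vs) S → ∃ (IsSteinerDistance G S)
    steinerDistance S t S⊆t with minimal (treeCover? S) (_ , t , length-tree t , S⊆t)
    ... | k , (vs , t , |vs|≡1+k , S⊆vs) , minimum =
      k , (treeSubgraph t , (tree-connected t , S⊆vs) , suc-injective (trans (sym (length-tree t)) |vs|≡1+k)) , lower
      where
      lower : ∀ H → ConnectedOver G S H → k ≤ ‖_‖ G H
      lower H (H-connected , S⊆H) =
        let vs′ , t′ , H⊆t′ , small = spanning-tree H H-connected in
        ≤-trans (minimum (vs′ , t′ , length-tree t′ , All.map H⊆t′ S⊆H)) small

-- The grid

∣suc-m-n∣≡suc∣m-n∣ : ∀ {m n} → n ≤ m → ∣ suc m - n ∣ ≡ suc ∣ m - n ∣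
∣suc-m-n∣≡suc∣m-n∣ {m} z≤n     = cong suc (sym (∣-∣-identityʳ m))
∣suc-m-n∣≡suc∣m-n∣ (s≤s n≤m) = ∣suc-m-n∣≡suc∣m-n∣ n≤m

∣m-n∣≡suc∣suc-m-n∣ : ∀ {m n} → m < n → ∣ m - n ∣ ≡ suc ∣ suc m - n ∣
∣m-n∣≡suc∣suc-m-n∣ {m} {suc n} (s≤s m≤n) =
  trans (∣-∣-comm m (suc n)) (trans (∣suc-m-n∣≡suc∣m-n∣ m≤n) (cong suc (∣-∣-comm n m)))

path-adj-sym : ∀ {k} {a b : Fin k} → Adj (P k) a b → Adj (P k) b a
path-adj-sym (inj₁ e) = inj₂ e
path-adj-sym (inj₂ e) = inj₁ e

path-adj? : ∀ {k} (a b : Fin k) → Dec (Adj (P k) a b)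
path-adj? a b = (suc (toℕ a) ≟ℕ toℕ b) ⊎-dec (suc (toℕ b) ≟ℕ toℕ a)

path-step : ∀ {k} (a b : Fin k) → toℕ a ≢ toℕ b →
  ∃[ c ] (Adj (P k) a c × ∣ toℕ a - toℕ b ∣ ≡ suc ∣ toℕ c - toℕ b ∣)
path-step {k} a b a≢b with <-cmp (toℕ a) (toℕ b)
... | tri≈ _ a≡b _ = contradiction a≡b a≢b
... | tri< a<b _ _ =
  fromℕ< 1+a<k , inj₁ (sym (toℕ-fromℕ< 1+a<k)) ,
  trans (∣m-n∣≡suc∣suc-m-n∣ a<b) (cong (λ x → suc ∣ x - toℕ b ∣) (sym (toℕ-fromℕ< 1+a<k)))
  where
  1+a<k : suc (toℕ a) < k
  1+a<k = ≤-<-trans a<b (toℕ<n b)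
path-step (fsuc a) b _ | tri> _ _ b<1+a =
  inject₁ a , inj₂ (cong suc (toℕ-inject₁ a)) ,
  trans (∣suc-m-n∣≡suc∣m-n∣ (≤-pred b<1+a)) (cong (λ x → suc ∣ x - toℕ b ∣) (sym (toℕ-inject₁ a)))

module GridGraph (m n : ℕ) where

  Vertex : Set
  Vertex = Fin m × Fin n

  _≟ᵥ_ : (u v : Vertex) → Dec (u ≡ v)
  _≟ᵥ_ = ≡-dec _≟ᶠ_ _≟ᶠ_

  adj-sym : ∀ {u v} → Adj (Grid m n) u v → Adj (Grid m n) v u
  adj-sym (inj₁ (g≡g′ , h~h′)) = inj₁ (sym g≡g′ , path-adj-sym h~h′)
  adj-sym (inj₂ (h≡h′ , g~g′)) = inj₂ (sym h≡h′ , path-adj-sym g~g′)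

  adj? : ∀ u v → Dec (Adj (Grid m n) u v)
  adj? (g , h) (g′ , h′) = ((g ≟ᶠ g′) ×-dec path-adj? h h′) ⊎-dec ((h ≟ᶠ h′) ×-dec path-adj? g g′)

  ∈-verts : ∀ v → v ∈ verts (Grid m n)
  ∈-verts (g , h) = ∈-cartesianProduct⁺ (∈-allFin g) (∈-allFin h)

  open GrowthTrees (Grid m n) _≟ᵥ_ adj-sym
    using (Tree; root; grow; treeEdges; length-tree; treeSubgraph; tree-connected; steinerDistance)
  open import Data.List.Membership.DecPropositional _≟ᵥ_ using (_∈?_)

  column row : Vertex → ℕ
  column (g , _) = toℕ g
  row    (_ , h) = toℕ h

  gridDistance : Vertex → Vertex → ℕ
  gridDistance u v = ∣ column u - column v ∣ + ∣ row u - row v ∣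

  grid-step : ∀ u s → u ≢ s → ∃[ w ] (Adj (Grid m n) u w × gridDistance u s ≡ suc (gridDistance w s))
  grid-step (g , h) (g′ , h′) u≢s with toℕ g ≟ℕ toℕ g′ | toℕ h ≟ℕ toℕ h′
  ... | no g≢g′ | _ =
    let g₁ , g~g₁ , eq = path-step g g′ g≢g′ in
    (g₁ , h) , inj₂ (refl , g~g₁) , cong (_+ ∣ toℕ h - toℕ h′ ∣) eq
  ... | yes _ | no h≢h′ =
    let h₁ , h~h₁ , eq = path-step h h′ h≢h′ in
    (g , h₁) , inj₁ (refl , h~h₁) , trans (cong (∣ toℕ g - toℕ g′ ∣ +_) eq) (+-suc _ _)
  ... | yes g≡g′ | yes h≡h′ = contradiction (cong₂ _,_ (toℕ-injective g≡g′) (toℕ-injective h≡h′)) u≢s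

  record Extension (vs : List Vertex) (s : Vertex) (d : ℕ) : Set where
    field
      vertices : List Vertex
      tree     : Tree vertices
      extends  : ∀ {x} → x ∈ vs → x ∈ vertices
      reaches  : s ∈ vertices
      bounded  : length vertices ≤ length vs + d

  extend-toward : ∀ d {vs} → Tree vs → ∀ {u} → u ∈ vs → ∀ s → gridDistance u s ≡ d → Extension vs s d
  extend-toward d {vs} t {u} u∈vs s dist with u ≟ᵥ s
  ... | yes refl = record
    { vertices = vs ; tree = t ; extends = λ x∈vs → x∈vs ; reaches = u∈vs ; bounded = m≤m+n _ _ }
  ... | no u≢s with grid-step u s u≢s | d
  ...   | w , u~w , dist′ | zero  = contradiction (trans (sym dist) dist′) (λ ())
  ...   | w , u~w , dist′ | suc d with w ∈? vs
  ...     | yes w∈vs = record { Extension next ; bounded = ≤-trans (Extension.bounded next) (+-monoʳ-≤ (length vs) (n≤1+n d)) }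
    where next = extend-toward d t w∈vs s (suc-injective (trans (sym dist′) dist))
  ...     | no w∉vs  = record
    { Extension next ; extends = λ x∈vs → Extension.extends next (there x∈vs)
    ; bounded = ≤-trans (Extension.bounded next) (≤-reflexive (sym (+-suc (length vs) d))) }
    where next = extend-toward d (grow u u∈vs u~w w∉vs t) (here refl) s (suc-injective (trans (sym dist′) dist))

  -- The union of geodesics from c to the points of S.
  star-tree : ∀ c S → ∃[ vs ] Σ (Tree vs) λ t →
    c ∈ vs × All (_∈ vs) S × length (treeEdges t) ≤ Σ[ S ] (gridDistance c)
  star-tree c []      = _ , root c , here refl , [] , z≤n
  star-tree c (s ∷ S) =
    let vs , t , c∈vs , S⊆vs , small = star-tree c S
        open Extension (extend-toward _ t c∈vs s refl)
    in vertices , tree , extends c∈vs , reaches ∷ All.map extends S⊆vs ,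
       ≤-pred (begin
         suc (length (treeEdges tree)) ≡⟨ length-tree tree ⟨
         length vertices               ≤⟨ bounded ⟩
         length vs + gridDistance c s  ≡⟨ cong (_+ gridDistance c s) (length-tree t) ⟩
         suc (length (treeEdges t) + gridDistance c s) ≤⟨ s≤s (+-monoˡ-≤ (gridDistance c s) small) ⟩
         suc (Σ[ S ] (gridDistance c) + gridDistance c s) ≡⟨ cong suc (+-comm _ (gridDistance c s)) ⟩
         suc (Σ[ s ∷ S ] (gridDistance c)) ∎)
    where open ≤-Reasoning

  -- An edge between columns c and c + 1 is labelled inj₁ c, one between rows r and r + 1 is labelled inj₂ r.
  label : Vertex × Vertex → ℕ ⊎ ℕ
  label ((g , h) , (g′ , h′)) with h ≟ᶠ h′
  ... | yes _ = inj₁ (toℕ g ⊓ toℕ g′)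
  ... | no _  = inj₂ (toℕ h ⊓ toℕ h′)

  private
    label-horizontal : ∀ g g′ h → label ((g , h) , (g′ , h)) ≡ inj₁ (toℕ g ⊓ toℕ g′)
    label-horizontal g g′ h with h ≟ᶠ h
    ... | yes _   = refl
    ... | no h≢h = contradiction refl h≢h

    label-vertical : ∀ g h h′ → h ≢ h′ → label ((g , h) , (g , h′)) ≡ inj₂ (toℕ h ⊓ toℕ h′)
    label-vertical g h h′ h≢h′ with h ≟ᶠ h′
    ... | yes h≡h′ = contradiction h≡h′ h≢h′
    ... | no _      = refl

    ⊓-crossing : ∀ {a b c} → suc a ≡ b → a ≤ c → c < b → a ⊓ b ≡ c × b ⊓ a ≡ c
    ⊓-crossing {a} refl a≤c c<1+a with ≤-antisym a≤c (≤-pred c<1+a)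
    ... | refl = m≤n⇒m⊓n≡m (n≤1+n a) , m≥n⇒m⊓n≡n (n≤1+n a)

    no-downward-crossing : ∀ {a b c} → suc b ≡ a → a ≤ c → c < b → ⊥
    no-downward-crossing refl 1+b≤c c<b = <-asym 1+b≤c c<b

    no-flat-crossing : ∀ {a c} → a ≤ c → c < a → ⊥
    no-flat-crossing a≤c c<a = <-irrefl refl (≤-<-trans a≤c c<a)

  crosses-column : ∀ {u w c} → Adj (Grid m n) u w → column u ≤ c → c < column w →
                   label (u , w) ≡ inj₁ c × label (w , u) ≡ inj₁ c
  crosses-column (inj₁ (refl , _)) u≤c c<w = ⊥-elim (no-flat-crossing u≤c c<w)
  crosses-column {g , h} {g′ , _} (inj₂ (refl , inj₁ up)) u≤c c<w =
    let uw , wu = ⊓-crossing up u≤c c<w in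
    trans (label-horizontal g g′ h) (cong inj₁ uw) , trans (label-horizontal g′ g h) (cong inj₁ wu)
  crosses-column (inj₂ (refl , inj₂ down)) u≤c c<w = ⊥-elim (no-downward-crossing down u≤c c<w)

  crosses-row : ∀ {u w c} → Adj (Grid m n) u w → row u ≤ c → c < row w →
                label (u , w) ≡ inj₂ c × label (w , u) ≡ inj₂ c
  crosses-row {g , h} {_ , h′} (inj₁ (refl , inj₁ up)) u≤c c<w =
    let uw , wu = ⊓-crossing up u≤c c<w in
    trans (label-vertical g h h′ (λ { refl → 1+n≢n up })) (cong inj₂ uw) ,
    trans (label-vertical g h′ h (λ { refl → 1+n≢n up })) (cong inj₂ wu)
  crosses-row (inj₁ (refl , inj₂ down)) u≤c c<w = ⊥-elim (no-downward-crossing down u≤c c<w)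
  crosses-row (inj₂ (refl , _)) u≤c c<w = ⊥-elim (no-flat-crossing u≤c c<w)

  module Triple (a b c : Vertex) where

    S : List Vertex
    S = a ∷ b ∷ c ∷ []

    horizontal : Spread column a b c
    horizontal = spread column a b c

    vertical : Spread row a b c
    vertical = spread row a b c

    open Spread horizontal using () renaming (width to width₁)
    open Spread vertical using () renaming (width to width₂)

    median : Vertex
    median = proj₁ (Spread.mid horizontal) , proj₂ (Spread.mid vertical)

    Σ-gridDistance-median : Σ[ S ] (gridDistance median) ≡ width₁ + width₂
    Σ-gridDistance-median =
      trans (regroup (∣ column median - column a ∣) _ _ (∣ row median - row a ∣) _ _)
            (cong₂ _+_ (Spread.mid-sum horizontal) (Spread.mid-sum vertical))
      where
      regroup : ∀ x₁ x₂ x₃ y₁ y₂ y₃ → (x₁ + y₁) + ((x₂ + y₂) + ((x₃ + y₃) + 0)) ≡ (x₁ + x₂ + x₃) + (y₁ + y₂ + y₃)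
      regroup = solve-∀

    2*width≡pairwiseSum : 2 * (width₁ + width₂) ≡ pairwiseSum gridDistance S
    2*width≡pairwiseSum = begin
      2 * (width₁ + width₂)     ≡⟨ *-distribˡ-+ 2 width₁ width₂ ⟩
      2 * width₁ + 2 * width₂   ≡⟨ cong₂ _+_ (Spread.pairwise-sum horizontal) (Spread.pairwise-sum vertical) ⟨
      _                         ≡⟨ regroup (∣ column a - column b ∣) _ _ (∣ row a - row b ∣) _ _ ⟩
      pairwiseSum gridDistance S ∎
      where
      open ≡-Reasoning
      regroup : ∀ x₁ x₂ x₃ y₁ y₂ y₃ → (x₁ + x₂ + x₃) + (y₁ + y₂ + y₃) ≡ ((x₁ + y₁) + ((x₂ + y₂) + 0)) + (((x₃ + y₃) + 0) + 0)
      regroup = solve-∀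

    -- Each column gap and each row gap between the extreme points is crossed by a separate edge.
    lower-bound : ∀ H → ConnectedOver (Grid m n) S H → width₁ + width₂ ≤ ‖_‖ (Grid m n) H
    lower-bound H ((_ , walks) , S⊆H) = begin
      width₁ + width₂               ≡⟨ cong₂ _+_ (length-applyUpTo _ width₁) (length-applyUpTo _ width₂) ⟨
      length K₁ + length K₂         ≡⟨ length-++ K₁ ⟨
      length (K₁ ++ K₂)             ≤⟨ length-≤-⊆ unique K⊆labels ⟩
      length (map label (he H))     ≡⟨ length-map label (he H) ⟩
      length (he H)                 ∎
      where
      open ≤-Reasoning
      open Spread horizontal using () renaming (lo to lo₁; hi to hi₁; lo∈ to lo₁∈; hi∈ to hi₁∈; lo≤hi to lo₁≤hi₁)
      open Spread vertical using () renaming (lo to lo₂; hi to hi₂; lo∈ to lo₂∈; hi∈ to hi₂∈; lo≤hi to lo₂≤hi₂)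
      K₁ K₂ : List (ℕ ⊎ ℕ)
      K₁ = applyUpTo (λ i → inj₁ (column lo₁ + i)) width₁
      K₂ = applyUpTo (λ i → inj₂ (row lo₂ + i)) width₂
      unique : Unique (K₁ ++ K₂)
      unique = Unique.++⁺
        (Unique.applyUpTo⁺₁ _ width₁ λ i<j _ eq → <⇒≢ i<j (+-cancelˡ-≡ _ _ _ (inj₁-injective eq)))
        (Unique.applyUpTo⁺₁ _ width₂ λ i<j _ eq → <⇒≢ i<j (+-cancelˡ-≡ _ _ _ (inj₂-injective eq)))
        λ (l∈K₁ , l∈K₂) → case (∈-applyUpTo⁻ _ l∈K₁ , ∈-applyUpTo⁻ _ l∈K₂) of λ
          { ((_ , _ , refl) , (_ , _ , ())) }
      K⊆labels : ∀ {l} → l ∈ K₁ ++ K₂ → l ∈ map label (he H)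
      K⊆labels l∈K with ∈-++⁻ K₁ l∈K
      ... | inj₁ l∈K₁ = walk-crosses-levels adj-sym column label inj₁ crosses-column
                          (walks lo₁ hi₁ (All.lookup S⊆H lo₁∈) (All.lookup S⊆H hi₁∈)) lo₁≤hi₁ l∈K₁
      ... | inj₂ l∈K₂ = walk-crosses-levels adj-sym row label inj₂ crosses-row
                          (walks lo₂ hi₂ (All.lookup S⊆H lo₂∈) (All.lookup S⊆H hi₂∈)) lo₂≤hi₂ l∈K₂

    steinerDistance-triple : ∀ {k} → IsSteinerDistance (Grid m n) S k → 2 * k ≡ pairwiseSum gridDistance S
    steinerDistance-triple isSD =
      let vs , t , _ , S⊆t , small = star-tree median S in
      trans (cong (2 *_) (steinerDistance-≡ isSD (treeSubgraph t) (tree-connected t , S⊆t)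
                                            (subst (length (treeEdges t) ≤_) Σ-gridDistance-median small) lower-bound))
            2*width≡pairwiseSum

  gridDistance-sym : ∀ u v → gridDistance u v ≡ gridDistance v u
  gridDistance-sym u v = cong₂ _+_ (∣-∣-comm (column u) (column v)) (∣-∣-comm (row u) (row v))

  gridDistance-refl : ∀ u → gridDistance u u ≡ 0
  gridDistance-refl u = cong₂ _+_ (∣n-n∣≡0 (column u)) (∣n-n∣≡0 (row u))

  length-verts : length (verts (Grid m n)) ≡ m * n
  length-verts = trans (length-cartesianProduct (allFin m) (allFin n)) (cong₂ _*_ (length-allFin m) (length-allFin n))

  2*pairwiseSum-grid : 2 * pairwiseSum gridDistance (verts (Grid m n)) ≡ n * n * pathDistanceSum m + m * m * pathDistanceSum n
  2*pairwiseSum-grid = begin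
    2 * pairwiseSum gridDistance (verts (Grid m n))
      ≡⟨ 2*pairwiseSum≡ΣΣ gridDistance gridDistance-sym gridDistance-refl (verts (Grid m n)) ⟩
    Σ[ verts (Grid m n) ] (λ u → Σ[ verts (Grid m n) ] (gridDistance u))
      ≡⟨ ΣΣ-cartesianProduct (allFin m) (allFin n) (λ g g′ → ∣ toℕ g - toℕ g′ ∣) (λ h h′ → ∣ toℕ h - toℕ h′ ∣) ⟩
    length (allFin n) * length (allFin n) * pathDistanceSum m + length (allFin m) * length (allFin m) * pathDistanceSum n
      ≡⟨ cong₂ (λ k l → k * k * pathDistanceSum m + l * l * pathDistanceSum n) (length-allFin n) (length-allFin m) ⟩
    n * n * pathDistanceSum m + m * m * pathDistanceSum n ∎
    where open ≡-Reasoning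

  2*SW₃≡Σ-pairwiseSum : ∀ d → (∀ S → IsSteinerDistance (Grid m n) S (d S)) →
    2 * SW₃ (Grid m n) d ≡ Σ[ 3-subsets (Grid m n) ] (pairwiseSum gridDistance)
  2*SW₃≡Σ-pairwiseSum d isSD = trans (sym (Σ-*ˡ (3-subsets (Grid m n)) 2 d))
    (Σ-cong-All (All.map (λ { (a , b , c , refl) → Triple.steinerDistance-triple a b c (isSD _) })
                          (triplesOf-shape (verts (Grid m n)))))

  steinerDistance-grid : Vertex → ∀ S → ∃ (IsSteinerDistance (Grid m n) S)
  steinerDistance-grid v S = let _ , t , _ , S⊆t , _ = star-tree v S in steinerDistance adj? ∈-verts S t S⊆t

  2*SW₃+2*pairwiseSum : ∀ d → (∀ S → IsSteinerDistance (Grid m n) S (d S)) →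
    let p = pairwiseSum gridDistance (verts (Grid m n)) in 2 * SW₃ (Grid m n) d + 2 * p ≡ m * n * p
  2*SW₃+2*pairwiseSum d isSD = begin
    2 * SW₃ (Grid m n) d + 2 * p                     ≡⟨ cong (_+ 2 * p) (2*SW₃≡Σ-pairwiseSum d isSD) ⟩
    Σ[ 3-subsets (Grid m n) ] (pairwiseSum gridDistance) + 2 * p ≡⟨ Σ-triplesOf-pairwiseSum gridDistance (verts (Grid m n)) ⟩
    length (verts (Grid m n)) * p                    ≡⟨ cong (_* p) length-verts ⟩
    m * n * p                                        ∎
    where
    open ≡-Reasoning
    p : ℕ
    p = pairwiseSum gridDistance (verts (Grid m n))

-- Substituting m ^ 3 = a + m and n ^ 3 = b + n turns the claim into a polynomial identity in m, n, a, b.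
grid-arithmetic : ∀ m n s p dm dn →
  2 * s + 2 * p ≡ m * n * p → 2 * p ≡ n * n * dm + m * m * dn →
  3 * dm + m ≡ m * m * m → 3 * dn + n ≡ n * n * n →
  12 * s + 3 * (m ^ 3 * n ^ 2) + 3 * (m ^ 2 * n ^ 3) ≡ m ^ 4 * n ^ 3 + m ^ 3 * n ^ 4 + 2 * (m ^ 2 * n) + 2 * (m * n ^ 2)
grid-arithmetic m n s p dm dn triples pairs cube-m cube-n = +-cancelʳ-≡ (2 * q) _ _ (begin
  12 * s + 3 * (m ^ 3 * n ^ 2) + 3 * (m ^ 2 * n ^ 3) + 2 * q
                               ≡⟨ shuffle (12 * s) (3 * (m ^ 3 * n ^ 2)) (3 * (m ^ 2 * n ^ 3)) (2 * q) ⟩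
  (12 * s + 2 * q) + c         ≡⟨ cong (_+ c) scaled ⟩
  m * n * q + c                ≡⟨ lhs-cubes m n a b ⟩
  L (m * m * m) (n * n * n)    ≡⟨ cong₂ L cube-m cube-n ⟨
  L (a + m) (b + n)            ≡⟨ identity m n a b ⟩
  R (a + m) (b + n)            ≡⟨ cong₂ R cube-m cube-n ⟩
  R (m * m * m) (n * n * n)    ≡⟨ rhs-cubes m n a b ⟩
  rhs + 2 * q                  ∎)
  where
  open ≡-Reasoning
  a b q c rhs : ℕ
  a = 3 * dm
  b = 3 * dn
  q = n * n * a + m * m * b
  c = 3 * (m ^ 3 * n ^ 2) + 3 * (m ^ 2 * n ^ 3)
  rhs = m ^ 4 * n ^ 3 + m ^ 3 * n ^ 4 + 2 * (m ^ 2 * n) + 2 * (m * n ^ 2)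
  L R : ℕ → ℕ → ℕ
  L M N = m * N * a + M * n * b + 3 * (M * (n * n)) + 3 * (m * m * N)
  R M N = m * M * N + M * n * N + 2 * (m * m * n) + 2 * (m * (n * n)) + 2 * q
  scaled : 12 * s + 2 * q ≡ m * n * q
  scaled = begin
    12 * s + 2 * q                  ≡⟨ six-fold m n s dm dn ⟩
    6 * (2 * s + p′)                ≡⟨ cong (λ t → 6 * (2 * s + t)) pairs ⟨
    6 * (2 * s + 2 * p)             ≡⟨ cong (6 *_) triples ⟩
    6 * (m * n * p)                 ≡⟨ regroup (m * n) p ⟩
    m * n * (3 * (2 * p))           ≡⟨ cong (λ t → m * n * (3 * t)) pairs ⟩
    m * n * (3 * p′)                ≡⟨ cong (m * n *_) (three-fold m n dm dn) ⟩
    m * n * q                       ∎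
    where
    p′ : ℕ
    p′ = n * n * dm + m * m * dn
    six-fold : ∀ m n s x y → 12 * s + 2 * (n * n * (3 * x) + m * m * (3 * y)) ≡ 6 * (2 * s + (n * n * x + m * m * y))
    six-fold = solve-∀
    regroup : ∀ k p → 6 * (k * p) ≡ k * (3 * (2 * p))
    regroup = solve-∀
    three-fold : ∀ m n x y → 3 * (n * n * x + m * m * y) ≡ n * n * (3 * x) + m * m * (3 * y)
    three-fold = solve-∀
  shuffle : ∀ x y z w → x + y + z + w ≡ (x + w) + (y + z)
  shuffle = solve-∀
  lhs-cubes : ∀ m n a b → m * n * (n * n * a + m * m * b) + (3 * (m * (m * (m * 1)) * (n * (n * 1))) + 3 * (m * (m * 1) * (n * (n * (n * 1)))))
    ≡ m * (n * n * n) * a + m * m * m * n * b + 3 * (m * m * m * (n * n)) + 3 * (m * m * (n * n * n))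
  lhs-cubes = solve-∀
  identity : ∀ m n a b →
    m * (b + n) * a + (a + m) * n * b + 3 * ((a + m) * (n * n)) + 3 * (m * m * (b + n))
    ≡ m * (a + m) * (b + n) + (a + m) * n * (b + n) + 2 * (m * m * n) + 2 * (m * (n * n)) + 2 * (n * n * a + m * m * b)
  identity = solve-∀
  rhs-cubes : ∀ m n a b →
    m * (m * m * m) * (n * n * n) + m * m * m * n * (n * n * n) + 2 * (m * m * n) + 2 * (m * (n * n)) + 2 * (n * n * a + m * m * b)
    ≡ m * (m * (m * (m * 1))) * (n * (n * (n * 1))) + m * (m * (m * 1)) * (n * (n * (n * (n * 1))))
      + 2 * (m * (m * 1) * n) + 2 * (m * (n * (n * 1))) + 2 * (n * n * a + m * m * b)
  rhs-cubes = solve-∀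

proposition6p1 : ∀ (m n : ℕ) → m ≥ 2 → n ≥ 2 →
    (Σ (List (V (Grid m n)) → ℕ) λ d → ∀ S → IsSteinerDistance (Grid m n) S (d S)) ×
    (∀ (d : List (V (Grid m n)) → ℕ) →
      (∀ S → IsSteinerDistance (Grid m n) S (d S)) →
      12 * SW₃ (Grid m n) d + 3 * (m ^ 3 * n ^ 2) + 3 * (m ^ 2 * n ^ 3)
        ≡ m ^ 4 * n ^ 3 + m ^ 3 * n ^ 4 + 2 * (m ^ 2 * n) + 2 * (m * n ^ 2))
proposition6p1 m@(suc _) n@(suc _) _ _ =
  ((λ S → proj₁ (steinerDistance-grid corner S)) , (λ S → proj₂ (steinerDistance-grid corner S))) ,
  λ d isSD → grid-arithmetic m n (SW₃ (Grid m n) d) (pairwiseSum gridDistance (verts (Grid m n)))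
               (pathDistanceSum m) (pathDistanceSum n)
               (2*SW₃+2*pairwiseSum d isSD)
               2*pairwiseSum-grid (3*pathDistanceSum+k≡k³ m) (3*pathDistanceSum+k≡k³ n)
  where
  open GridGraph m n
  corner : Vertex
  corner = fzero , fzero
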